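{- Let $p>3$ be a prime and let $j\in\{2,3,\ldots,p-1\}$. Define $$L_p(j)=\Big\{\, i\in\{1,2,\ldots,\tfrac{p-1}{2}\} \;:\; \{i(j-1)\}_p<\tfrac{p}{2}<\{ij\}_p\Big\}.$$ Then $|L_p(j)|\equiv \frac{p^2-1}{8}\pmod 2$.
   Context: For an integer $x$, $\{x\}_p$ denotes the least nonnegative residue of $x$ modulo $p$; $|A|$ is the cardinality of a set $A$. -}

module Defs where

open import Data.Nat using (ℕ; suc; _+_; _*_; _∸_; _<_; _<?_; _/_; _%_; NonZero)
open import Data.List using (List; filter; length; map; upTo)
open import Data.Product using (_×_)
open import Relation.Nullary.Decidable using (_×-dec_)

residue : (p : ℕ) → .{{NonZero p}} → ℕ → ℕ
residue p x = x % p

-- L_p(j) = { i ∈ {1,…,(p-1)/2} : {i(j-1)}_p < p/2 < {ij}_p }, as a duplicate-free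
-- increasing list.  Over ℕ, a < p/2 ⇔ 2a < p and p/2 < b ⇔ p < 2b.
Lp : (p : ℕ) → .{{NonZero p}} → ℕ → List ℕ
Lp p j = filter (λ i → (2 * residue p (i * (j ∸ 1)) <? p) ×-dec (p <? 2 * residue p (i * j)))
                (map suc (upTo ((p ∸ 1) / 2)))

module Submission where

-- Write p = 2n + 1 and fold r ∈ {0,…,n} for the absolute
-- least residue of r ∈ [0,p): fold r = r if r ≤ n, and p − r otherwise.
-- For j = k + 1 and 1 ≤ i ≤ n put a = {ik}_p and b = {i(k+1)}_p = {a + i}_p.
--  (1) Crossing parity: fold a + fold b + [a < p/2 < b] + i is even.  This is
--      a case analysis on whether a + i wraps around p and on which halves
--      of [0,p) the residues a and b lie in.
--  (2) Gauss's lemma: for p prime and p ∤ k the map i ↦ fold {ik}_p permutes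
--      {1,…,n}, so its values sum to T_n = 1 + ⋯ + n.
-- Summing (1) over i = 1,…,n and using (2) for k and k + 1 gives
-- 2 ∣ T_n + T_n + |L_p(j)| + T_n, hence |L_p(j)| ≡ T_n (mod 2); finally
-- T_n = (p² − 1)/8.  The file first develops finite sums over {1,…,n} and
-- the reindexing lemma behind (2), then the arithmetic of an odd modulus,
-- and derives the theorem at the end.

open import Defs
open import Data.Nat using (ℕ; zero; suc; _+_; _*_; _∸_; _≤_; _<_; _/_; _%_; NonZero; z≤n; s≤s; s≤s⁻¹; _≤?_; _<?_)
open import Data.Nat.Properties
open import Data.Nat.DivMod using (m≡m%n+[m/n]*n; m%n<n; m<n⇒m%n≡m; [m+n]%n≡m%n; [m+kn]%n≡m%n; %-distribˡ-+; %-remove-+ˡ; n%n≡0; m*n/n≡m)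
open import Data.Nat.Divisibility using (_∣_; divides; ∣⇒≤; m%n≡0⇒n∣m; ∣m∣n⇒∣m+n; ∣m+n∣m⇒∣n; _∣0)
open import Data.Nat.Primality using (Prime; euclidsLemma; prime⇒irreducible)
open import Data.Nat.Tactic.RingSolver using (solve-∀)
open import Data.Bool.Base using (true; false; if_then_else_)
open import Data.Fin using (Fin; zero; suc; toℕ; fromℕ<; punchOut)
open import Data.Fin.Properties using (toℕ<n; toℕ-fromℕ<; toℕ-fromℕ; toℕ-inject₁; toℕ-injective; any?; punchOut-injective; injective⇒≤)
  renaming (_≟_ to _≟ᶠ_)
open import Data.List using (List; length; filter; map; upTo; applyUpTo)
open import Data.List.Properties using (map-applyUpTo)
open import Data.Product using (_×_; _,_)
open import Data.Sum using (_⊎_; inj₁; inj₂)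
open import Data.Empty using (⊥-elim)
open import Function using (_∘_; id)
open import Function.Definitions using (Injective; Surjective)
open import Function.Bundles using (mk⤖)
open import Function.Properties.Bijection using (⤖⇒↔)
open import Relation.Nullary using (Dec; yes; no; ¬_; does)
open import Relation.Nullary.Decidable using (_×-dec_)
open import Relation.Nullary.Negation using (contradiction)
open import Relation.Binary.PropositionalEquality
  using (_≡_; _≢_; refl; sym; trans; cong; cong₂; subst; module ≡-Reasoning)
open import Algebra.Properties.CommutativeMonoid.Sum +-0-commutativeMonoid
  using (sum; sum-cong-≗; ∑-distrib-+; sum-permute; sum-init-last)

open ≡-Reasoning

sumTo : ℕ → (ℕ → ℕ) → ℕ
sumTo n f = sum (λ (i : Fin n) → f (suc (toℕ i)))

sumTo-suc : ∀ n f → sumTo (suc n) f ≡ sumTo n f + f (suc n)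
sumTo-suc n f = trans (sum-init-last {n} (λ i → f (suc (toℕ i))))
  (cong₂ _+_ (sum-cong-≗ {n} (λ i → cong (f ∘ suc) (toℕ-inject₁ i))) (cong (f ∘ suc) (toℕ-fromℕ n)))

sumTo-+ : ∀ n f g → sumTo n (λ i → f i + g i) ≡ sumTo n f + sumTo n g
sumTo-+ n f g = ∑-distrib-+ {n} (λ i → f (suc (toℕ i))) (λ i → g (suc (toℕ i)))

sum-pres-∣ : ∀ {d n} (f : Fin n → ℕ) → (∀ i → d ∣ f i) → d ∣ sum f
sum-pres-∣ {d} {zero} f _ = d ∣0
sum-pres-∣ {d} {suc n} f d∣f = ∣m∣n⇒∣m+n (d∣f zero) (sum-pres-∣ (f ∘ suc) (d∣f ∘ suc))

injective⇒surjective : ∀ {n} (h : Fin n → Fin n) → Injective _≡_ _≡_ h → Surjective _≡_ _≡_ h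
injective⇒surjective {suc m} h h-inj y with any? (λ i → h i ≟ᶠ y)
... | yes (x , hx≡y) = x , λ { refl → hx≡y }
... | no y∉im = contradiction (injective⇒≤ squeezed-injective) (1+n≰n {m})
  where
  squeezed : Fin (suc m) → Fin m
  squeezed i = punchOut {i = y} {j = h i} (λ y≡hi → y∉im (i , sym y≡hi))
  squeezed-injective : Injective _≡_ _≡_ squeezed
  squeezed-injective {i} {k} e =
    h-inj (punchOut-injective (λ y≡hi → y∉im (i , sym y≡hi)) (λ y≡hk → y∉im (k , sym y≡hk)) e)

sum-reindex : ∀ {n} (f : Fin n → ℕ) (h : Fin n → Fin n) → Injective _≡_ _≡_ h → sum f ≡ sum (f ∘ h)
sum-reindex f h h-inj = sum-permute f (⤖⇒↔ (mk⤖ (h-inj , injective⇒surjective h h-inj)))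

InRange : ℕ → ℕ → Set
InRange n i = 0 < i × i ≤ n

toFin : ∀ {n i} → InRange n i → Fin n
toFin {i = suc i} (_ , i<n) = fromℕ< i<n

toFin-correct : ∀ {n i} (r : InRange n i) → suc (toℕ (toFin r)) ≡ i
toFin-correct {i = suc i} (_ , i<n) = cong suc (toℕ-fromℕ< i<n)

fromFin : ∀ {n} (k : Fin n) → InRange n (suc (toℕ k))
fromFin k = s≤s z≤n , toℕ<n k

sumTo-permutation : ∀ n (σ : ℕ → ℕ) →
                    (∀ {i} → InRange n i → InRange n (σ i)) →
                    (∀ {i i'} → InRange n i → InRange n i' → σ i ≡ σ i' → i ≡ i') →
                    sumTo n σ ≡ sumTo n id
sumTo-permutation n σ σ-into σ-inj = begin
  sumTo n σ            ≡⟨ sum-cong-≗ {n} (λ k → sym (toFin-correct (σ-into (fromFin k)))) ⟩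
  sum (suc ∘ toℕ ∘ h)  ≡⟨ sum-reindex (suc ∘ toℕ) h h-injective ⟨
  sumTo n id           ∎
  where
  h : Fin n → Fin n
  h k = toFin (σ-into (fromFin k))
  h-injective : Injective _≡_ _≡_ h
  h-injective {k} {k'} e = toℕ-injective (suc-injective (σ-inj (fromFin k) (fromFin k') (begin
    σ (suc (toℕ k))   ≡⟨ toFin-correct (σ-into (fromFin k)) ⟨
    suc (toℕ (h k))   ≡⟨ cong (suc ∘ toℕ) e ⟩
    suc (toℕ (h k'))  ≡⟨ toFin-correct (σ-into (fromFin k')) ⟩
    σ (suc (toℕ k'))  ∎)))

triangular : ℕ → ℕ
triangular n = sumTo n id

triangular-closed : ∀ n → 2 * triangular n ≡ n * suc n
triangular-closed zero = refl
triangular-closed (suc n) = begin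
  2 * triangular (suc n)        ≡⟨ cong (2 *_) (sumTo-suc n id) ⟩
  2 * (triangular n + suc n)    ≡⟨ *-distribˡ-+ 2 (triangular n) (suc n) ⟩
  2 * triangular n + 2 * suc n  ≡⟨ cong (_+ 2 * suc n) (triangular-closed n) ⟩
  n * suc n + 2 * suc n         ≡⟨ shift n ⟩
  suc n * suc (suc n)           ∎
  where
  shift : ∀ n → n * suc n + 2 * suc n ≡ suc n * suc (suc n)
  shift = solve-∀

odd-square : ∀ n → (suc (2 * n) * suc (2 * n) ∸ 1) / 8 ≡ triangular n
odd-square n = trans (cong (_/ 8) square-minus-one) (m*n/n≡m (triangular n) 8)
  where
  expand : ∀ n → 2 * n + 2 * n * suc (2 * n) ≡ 4 * (n * suc n)
  expand = solve-∀
  regroup : ∀ t → 4 * (2 * t) ≡ t * 8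
  regroup = solve-∀
  square-minus-one : suc (2 * n) * suc (2 * n) ∸ 1 ≡ triangular n * 8
  square-minus-one = begin
    2 * n + 2 * n * suc (2 * n)  ≡⟨ expand n ⟩
    4 * (n * suc n)              ≡⟨ cong (4 *_) (triangular-closed n) ⟨
    4 * (2 * triangular n)       ≡⟨ regroup (triangular n) ⟩
    triangular n * 8             ∎

indicator : ∀ {A : Set} → Dec A → ℕ
indicator d = if does d then 1 else 0

indicator-yes : ∀ {A : Set} (d : Dec A) → A → indicator d ≡ 1
indicator-yes (yes _) _ = refl
indicator-yes (no ¬a) a = contradiction a ¬a

indicator-no : ∀ {A : Set} (d : Dec A) → ¬ A → indicator d ≡ 0
indicator-no (yes a) ¬a = contradiction a ¬a
indicator-no (no _) _ = refl

length-filter-applyUpTo : ∀ {P : ℕ → Set} (P? : ∀ x → Dec (P x)) f n →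
                          length (filter P? (applyUpTo f n)) ≡ sum (λ (i : Fin n) → indicator (P? (f (toℕ i))))
length-filter-applyUpTo P? f zero = refl
length-filter-applyUpTo P? f (suc n) with does (P? (f 0))
... | true = cong suc (length-filter-applyUpTo P? (f ∘ suc) n)
... | false = length-filter-applyUpTo P? (f ∘ suc) n

length-filter-range : ∀ {P : ℕ → Set} (P? : ∀ x → Dec (P x)) n →
                      length (filter P? (map suc (upTo n))) ≡ sumTo n (λ i → indicator (P? i))
length-filter-range P? n =
  trans (cong (length ∘ filter P?) (map-applyUpTo id suc n)) (length-filter-applyUpTo P? suc n)

∤-between : ∀ {d x} → 0 < x → x < d → ¬ d ∣ x
∤-between {x = suc x} _ x<d d∣x = <⇒≱ x<d (∣⇒≤ d∣x)

<∣⇒≡0 : ∀ {d x} → x < d → d ∣ x → x ≡ 0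
<∣⇒≡0 {x = zero} _ _ = refl
<∣⇒≡0 {x = suc x} x<d d∣x = ⊥-elim (∤-between (s≤s z≤n) x<d d∣x)

%-≡⇒∣∸ : ∀ {d} .{{_ : NonZero d}} a b → a % d ≡ b % d → d ∣ b ∸ a
%-≡⇒∣∸ {d} a b e = divides (b / d ∸ a / d) (begin
  b ∸ a                                         ≡⟨ cong₂ _∸_ (m≡m%n+[m/n]*n b d) (m≡m%n+[m/n]*n a d) ⟩
  (b % d + (b / d) * d) ∸ (a % d + (a / d) * d)  ≡⟨ cong (λ x → (x + (b / d) * d) ∸ (a % d + (a / d) * d)) (sym e) ⟩
  (a % d + (b / d) * d) ∸ (a % d + (a / d) * d)  ≡⟨ [m+n]∸[m+o]≡n∸o (a % d) _ _ ⟩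
  (b / d) * d ∸ (a / d) * d                     ≡⟨ *-distribʳ-∸ d (b / d) (a / d) ⟨
  (b / d ∸ a / d) * d                           ∎)

even-sum⇒same-parity : ∀ x y → 2 ∣ x + y → x % 2 ≡ y % 2
even-sum⇒same-parity x y 2∣x+y = begin
  x % 2            ≡⟨ [m+kn]%n≡m%n x y 2 ⟨
  (x + y * 2) % 2  ≡⟨ cong (_% 2) (regroup x y) ⟩
  (x + y + y) % 2  ≡⟨ %-remove-+ˡ y 2∣x+y ⟩
  y % 2            ∎
  where
  regroup : ∀ x y → x + y * 2 ≡ x + y + y
  regroup = solve-∀

prime-odd : ∀ {p} → Prime p → 2 < p → p ≡ suc (2 * (p / 2))
prime-odd {p} p-prime 2<p = trans (m≡m%n+[m/n]*n p 2) (cong₂ _+_ p%2≡1 (*-comm (p / 2) 2))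
  where
  p%2≡1 : p % 2 ≡ 1
  p%2≡1 with p % 2 | m%n≡0⇒n∣m p 2 | m%n<n p 2
  ... | 0 | 2∣p | _ with prime⇒irreducible p-prime (2∣p refl)
  ...   | inj₁ ()
  ...   | inj₂ 2≡p = contradiction 2≡p (<⇒≢ 2<p)
  p%2≡1 | 1 | _ | _ = refl
  p%2≡1 | suc (suc _) | _ | s≤s (s≤s ())

module OddModulus (n : ℕ) where

  p : ℕ
  p = suc (2 * n)

  n<p : n < p
  n<p = s≤s (m≤m+n n (n + 0))

  half+half<p : ∀ {a b} → a ≤ n → b ≤ n → a + b < p
  half+half<p {a} {b} a≤n b≤n = s≤s (subst (a + b ≤_) (cong (n +_) (sym (+-identityʳ n))) (+-mono-≤ a≤n b≤n))

  fold : ℕ → ℕ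
  fold r with r ≤? n
  ... | yes _ = r
  ... | no _ = p ∸ r

  fold-small : ∀ {r} → r ≤ n → fold r ≡ r
  fold-small {r} r≤n with r ≤? n
  ... | yes _ = refl
  ... | no r≰n = contradiction r≤n r≰n

  fold-complement : ∀ {r s} → r + s ≡ p → n < r → fold r ≡ s
  fold-complement {r} {s} r+s≡p n<r with r ≤? n
  ... | yes r≤n = contradiction r≤n (<⇒≱ n<r)
  ... | no _ = trans (cong (_∸ r) (sym r+s≡p)) (m+n∸m≡n r s)

  fold-cases : ∀ {r} → r ≤ p → fold r ≡ r ⊎ fold r + r ≡ p
  fold-cases {r} r≤p with r ≤? n
  ... | yes _ = inj₁ refl
  ... | no _ = inj₂ (m∸n+n≡m r≤p)

  fold-≤ : ∀ r → fold r ≤ n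
  fold-≤ r with r ≤? n
  ... | yes r≤n = r≤n
  ... | no r≰n = ≤-trans (∸-monoʳ-≤ p (≰⇒> r≰n)) (≤-reflexive (trans (m+n∸m≡n n (n + 0)) (+-identityʳ n)))

  fold-pos : ∀ {r} → 0 < r → r < p → 0 < fold r
  fold-pos {r} 0<r r<p with r ≤? n
  ... | yes _ = 0<r
  ... | no _ = m<n⇒0<n∸m r<p

  fold-collision : ∀ {r s} → r ≤ p → s ≤ p → fold r ≡ fold s → r ≡ s ⊎ r + s ≡ p
  fold-collision {r} {s} r≤p s≤p e with fold-cases r≤p | fold-cases s≤p
  ... | inj₁ fr | inj₁ fs = inj₁ (trans (sym fr) (trans e fs))
  ... | inj₁ fr | inj₂ fs = inj₂ (trans (cong (_+ s) (trans (sym fr) e)) fs)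
  ... | inj₂ fr | inj₁ fs = inj₂ (trans (cong (r +_) (trans (sym fs) (sym e))) (trans (+-comm r (fold r)) fr))
  ... | inj₂ fr | inj₂ fs = inj₁ (+-cancelˡ-≡ (fold r) r s (trans fr (trans (sym fs) (cong (_+ s) (sym e)))))

  Crossing : ℕ → ℕ → Set
  Crossing a b = (2 * a < p) × (p < 2 * b)

  crossing? : ∀ a b → Dec (Crossing a b)
  crossing? a b = (2 * a <? p) ×-dec (p <? 2 * b)

  cross : ℕ → ℕ → ℕ
  cross a b = indicator (crossing? a b)

  below-half : ∀ {a} → a ≤ n → 2 * a < p
  below-half a≤n = s≤s (*-monoʳ-≤ 2 a≤n)

  below-half⁻¹ : ∀ {a} → 2 * a < p → a ≤ n
  below-half⁻¹ 2a<p = *-cancelˡ-≤ 2 (s≤s⁻¹ 2a<p)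

  above-half : ∀ {b} → n < b → p < 2 * b
  above-half {b} n<b = subst (_≤ 2 * b) (*-suc 2 n) (*-monoʳ-≤ 2 n<b)

  above-half⁻¹ : ∀ {b} → p < 2 * b → n < b
  above-half⁻¹ {b} p<2b = *-cancelˡ-≤ 2 (subst (_≤ 2 * b) (sym (*-suc 2 n)) p<2b)

  cross-yes : ∀ {a b} → a ≤ n → n < b → cross a b ≡ 1
  cross-yes {a} {b} a≤n n<b = indicator-yes (crossing? a b) (below-half a≤n , above-half n<b)

  cross-no-left : ∀ {a b} → n < a → cross a b ≡ 0
  cross-no-left {a} {b} n<a = indicator-no (crossing? a b) (λ (2a<p , _) → <⇒≱ n<a (below-half⁻¹ 2a<p))

  cross-no-right : ∀ {a b} → b ≤ n → cross a b ≡ 0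
  cross-no-right {a} {b} b≤n = indicator-no (crossing? a b) (λ (_ , p<2b) → <⇒≱ (above-half⁻¹ p<2b) b≤n)

  -- The quantity whose parity is controlled along the step a ↦ b = {a + I}_p.
  weight : ℕ → ℕ → ℕ → ℕ
  weight a b I = fold a + fold b + cross a b + I

  weight-≡ : ∀ a b I {x y c} → fold a ≡ x → fold b ≡ y → cross a b ≡ c → weight a b I ≡ x + y + c + I
  weight-≡ a b I refl refl refl = refl

  crossing-within : ∀ a I u → a + I + u ≡ p → 2 ∣ weight a (a + I) I
  crossing-within a I u a+I+u≡p with ≤-<-connex a n | ≤-<-connex (a + I) n
  ... | inj₁ a≤n | inj₁ b≤n = divides (a + I) (begin
    weight a (a + I) I   ≡⟨ weight-≡ a (a + I) I (fold-small a≤n) (fold-small b≤n) (cross-no-right {a = a} b≤n) ⟩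
    a + (a + I) + 0 + I  ≡⟨ both-low a I ⟩
    (a + I) * 2          ∎)
    where
    both-low : ∀ a I → a + (a + I) + 0 + I ≡ (a + I) * 2
    both-low = solve-∀
  ... | inj₁ a≤n | inj₂ n<b = divides (suc n) (begin
    weight a (a + I) I   ≡⟨ weight-≡ a (a + I) I (fold-small a≤n) (fold-complement a+I+u≡p n<b) (cross-yes a≤n n<b) ⟩
    a + u + 1 + I        ≡⟨ one-crossing a I u ⟩
    suc (a + I + u)      ≡⟨ cong suc a+I+u≡p ⟩
    suc p                ≡⟨ double-suc n ⟩
    suc n * 2            ∎)
    where
    one-crossing : ∀ a I u → a + u + 1 + I ≡ suc (a + I + u)
    one-crossing = solve-∀
    double-suc : ∀ n → suc (suc (2 * n)) ≡ suc n * 2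
    double-suc = solve-∀
  ... | inj₂ n<a | inj₁ b≤n = contradiction (≤-trans (m≤m+n a I) b≤n) (<⇒≱ n<a)
  ... | inj₂ n<a | inj₂ n<b = divides (I + u) (begin
    weight a (a + I) I   ≡⟨ weight-≡ a (a + I) I (fold-complement a+[I+u]≡p n<a) (fold-complement a+I+u≡p n<b)
                                     (cross-no-left {b = a + I} n<a) ⟩
    (I + u) + u + 0 + I  ≡⟨ both-high I u ⟩
    (I + u) * 2          ∎)
    where
    a+[I+u]≡p : a + (I + u) ≡ p
    a+[I+u]≡p = trans (sym (+-assoc a I u)) a+I+u≡p
    both-high : ∀ I u → (I + u) + u + 0 + I ≡ (I + u) * 2
    both-high = solve-∀

  -- Crossing parity when a + I wraps around p: then a lies above p/2 and the
  -- new residue c = a + I − p lies below it.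
  crossing-wrap : ∀ a I → a < p → I ≤ n → p ≤ a + I → 2 ∣ weight a ((a + I) % p) I
  crossing-wrap a I a<p I≤n p≤a+I = divides (c + v) (begin
    weight a ((a + I) % p) I  ≡⟨ cong (λ b → weight a b I) [a+I]%p≡c ⟩
    weight a c I              ≡⟨ weight-≡ a c I (fold-complement a+v≡p n<a) (fold-small c≤n) (cross-no-left {b = c} n<a) ⟩
    v + c + 0 + I             ≡⟨ cong (v + c + 0 +_) I≡c+v ⟩
    v + c + 0 + (c + v)       ≡⟨ wrapped c v ⟩
    (c + v) * 2               ∎)
    where
    c = a + I ∸ p
    v = p ∸ a
    c+p≡a+I : c + p ≡ a + I
    c+p≡a+I = m∸n+n≡m p≤a+I
    a+v≡p : a + v ≡ p
    a+v≡p = m+[n∸m]≡n (<⇒≤ a<p)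
    swap : ∀ c a v → c + (a + v) ≡ a + (c + v)
    swap = solve-∀
    I≡c+v : I ≡ c + v
    I≡c+v = +-cancelˡ-≡ a I (c + v) (begin
      a + I        ≡⟨ c+p≡a+I ⟨
      c + p        ≡⟨ cong (c +_) a+v≡p ⟨
      c + (a + v)  ≡⟨ swap c a v ⟩
      a + (c + v)  ∎)
    c≤n : c ≤ n
    c≤n = ≤-trans (m≤m+n c v) (subst (_≤ n) I≡c+v I≤n)
    n<a : n < a
    n<a with ≤-<-connex a n
    ... | inj₁ a≤n = contradiction p≤a+I (<⇒≱ (half+half<p a≤n I≤n))
    ... | inj₂ n<a = n<a
    [a+I]%p≡c : (a + I) % p ≡ c
    [a+I]%p≡c = trans (cong (_% p) (sym c+p≡a+I)) (trans ([m+n]%n≡m%n c p) (m<n⇒m%n≡m (≤-<-trans c≤n n<p)))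
    wrapped : ∀ c v → v + c + 0 + (c + v) ≡ (c + v) * 2
    wrapped = solve-∀

  crossing-parity : ∀ a I → a < p → I ≤ n → 2 ∣ weight a ((a + I) % p) I
  crossing-parity a I a<p I≤n with a + I <? p
  ... | yes a+I<p = subst (λ b → 2 ∣ weight a b I) (sym (m<n⇒m%n≡m a+I<p))
                          (crossing-within a I (p ∸ (a + I)) (m+[n∸m]≡n (<⇒≤ a+I<p)))
  ... | no a+I≮p = crossing-wrap a I a<p I≤n (≮⇒≥ a+I≮p)

  residue-step : ∀ i k → i < p → (i * suc k) % p ≡ ((i * k) % p + i) % p
  residue-step i k i<p = begin
    (i * suc k) % p            ≡⟨ cong (_% p) (trans (*-suc i k) (+-comm i (i * k))) ⟩
    (i * k + i) % p            ≡⟨ %-distribˡ-+ (i * k) i p ⟩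
    ((i * k) % p + i % p) % p  ≡⟨ cong (λ x → ((i * k) % p + x) % p) (m<n⇒m%n≡m i<p) ⟩
    ((i * k) % p + i) % p      ∎

  -- The i ∈ {1,…,m} at which i·k ↦ i·(k + 1) crosses p/2; for m = n this is L_p(k + 1).
  crossings : ℕ → ℕ → List ℕ
  crossings m k = filter (λ i → crossing? ((i * k) % p) ((i * suc k) % p)) (map suc (upTo m))

  module _ (p-prime : Prime p) where

    cancel-unit : ∀ {x k} → ¬ p ∣ k → p ∣ x * k → p ∣ x
    cancel-unit {x} {k} p∤k p∣xk with euclidsLemma x k p-prime p∣xk
    ... | inj₁ p∣x = p∣x
    ... | inj₂ p∣k = contradiction p∣k p∤k

    residue-pos : ∀ {i k} → ¬ p ∣ k → InRange n i → 0 < (i * k) % p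
    residue-pos {i} {k} p∤k (0<i , i≤n) = n≢0⇒n>0 λ ik%p≡0 →
      ∤-between 0<i (≤-<-trans i≤n n<p) (cancel-unit p∤k (m%n≡0⇒n∣m (i * k) p ik%p≡0))

    same-residue : ∀ {i i' k} → ¬ p ∣ k → i ≤ i' → i' < p → (i * k) % p ≡ (i' * k) % p → i ≡ i'
    same-residue {i} {i'} {k} p∤k i≤i' i'<p e = ≤-antisym i≤i' (m∸n≡0⇒m≤n (<∣⇒≡0 i'∸i<p p∣i'∸i))
      where
      i'∸i<p : i' ∸ i < p
      i'∸i<p = ≤-<-trans (m∸n≤m i' i) i'<p
      p∣i'∸i : p ∣ i' ∸ i
      p∣i'∸i = cancel-unit p∤k (subst (p ∣_) (sym (*-distribʳ-∸ k i' i)) (%-≡⇒∣∸ (i * k) (i' * k) e))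

    -- {ik}_p and {i'k}_p are not opposite for i, i' ∈ {1,…,n}, since p ∤ i + i'.
    opposite-residues : ∀ {i i' k} → ¬ p ∣ k → InRange n i → i' ≤ n → (i * k) % p + (i' * k) % p ≢ p
    opposite-residues {i} {i'} {k} p∤k (0<i , i≤n) i'≤n e =
      ∤-between (≤-trans 0<i (m≤m+n i i')) (half+half<p i≤n i'≤n) (cancel-unit p∤k (m%n≡0⇒n∣m _ p (begin
        ((i + i') * k) % p               ≡⟨ cong (_% p) (*-distribʳ-+ k i i') ⟩
        (i * k + i' * k) % p             ≡⟨ %-distribˡ-+ (i * k) (i' * k) p ⟩
        ((i * k) % p + (i' * k) % p) % p ≡⟨ cong (_% p) e ⟩
        p % p                            ≡⟨ n%n≡0 p ⟩
        0                                ∎)))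

    gauss-sum : ∀ {k} → ¬ p ∣ k → sumTo n (λ i → fold ((i * k) % p)) ≡ triangular n
    gauss-sum {k} p∤k = sumTo-permutation n (λ i → fold ((i * k) % p)) into injective
      where
      into : ∀ {i} → InRange n i → InRange n (fold ((i * k) % p))
      into {i} r = fold-pos (residue-pos p∤k r) (m%n<n (i * k) p) , fold-≤ ((i * k) % p)
      injective : ∀ {i i'} → InRange n i → InRange n i' → fold ((i * k) % p) ≡ fold ((i' * k) % p) → i ≡ i'
      injective {i} {i'} r@(_ , i≤n) r'@(_ , i'≤n) e
        with fold-collision (<⇒≤ (m%n<n (i * k) p)) (<⇒≤ (m%n<n (i' * k) p)) e
      ... | inj₂ opposite = contradiction opposite (opposite-residues p∤k r i'≤n)
      ... | inj₁ same with ≤-total i i'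
      ...   | inj₁ i≤i' = same-residue p∤k i≤i' (≤-<-trans i'≤n n<p) same
      ...   | inj₂ i'≤i = sym (same-residue p∤k i'≤i (≤-<-trans i≤n n<p) (sym same))

    crossings-parity : ∀ {k} → ¬ p ∣ k → ¬ p ∣ suc k → length (crossings n k) % 2 ≡ triangular n % 2
    crossings-parity {k} p∤k p∤k+1 = even-sum⇒same-parity L T (∣m+n∣m⇒∣n 2∣T+T+[L+T] 2∣T+T)
      where
      a b : ℕ → ℕ
      a i = (i * k) % p
      b i = (i * suc k) % p
      L T : ℕ
      L = length (crossings n k)
      T = triangular n
      L≡ : L ≡ sumTo n (λ i → cross (a i) (b i))
      L≡ = length-filter-range (λ i → crossing? (a i) (b i)) n
      step : ∀ {i} → InRange n i → 2 ∣ weight (a i) (b i) i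
      step {i} (_ , i≤n) = subst (λ x → 2 ∣ weight (a i) x i) (sym (residue-step i k (≤-<-trans i≤n n<p)))
                                 (crossing-parity (a i) i (m%n<n (i * k) p) i≤n)
      total : sumTo n (λ i → weight (a i) (b i) i) ≡ T + T + L + T
      total = begin
        sumTo n (λ i → weight (a i) (b i) i)
          ≡⟨ sumTo-+ n (λ i → fold (a i) + fold (b i) + cross (a i) (b i)) id ⟩
        sumTo n (λ i → fold (a i) + fold (b i) + cross (a i) (b i)) + T
          ≡⟨ cong (_+ T) (sumTo-+ n (λ i → fold (a i) + fold (b i)) (λ i → cross (a i) (b i))) ⟩
        sumTo n (λ i → fold (a i) + fold (b i)) + sumTo n (λ i → cross (a i) (b i)) + T
          ≡⟨ cong (λ x → x + sumTo n (λ i → cross (a i) (b i)) + T) (sumTo-+ n (fold ∘ a) (fold ∘ b)) ⟩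
        sumTo n (fold ∘ a) + sumTo n (fold ∘ b) + sumTo n (λ i → cross (a i) (b i)) + T
          ≡⟨ cong₂ (λ x y → x + y + sumTo n (λ i → cross (a i) (b i)) + T) (gauss-sum p∤k) (gauss-sum p∤k+1) ⟩
        T + T + sumTo n (λ i → cross (a i) (b i)) + T
          ≡⟨ cong (λ x → T + T + x + T) L≡ ⟨
        T + T + L + T ∎
      2∣T+T : 2 ∣ T + T
      2∣T+T = divides T (trans (cong (T +_) (sym (+-identityʳ T))) (*-comm 2 T))
      2∣T+T+[L+T] : 2 ∣ (T + T) + (L + T)
      2∣T+T+[L+T] = subst (2 ∣_) (trans total (+-assoc (T + T) L T))
                          (sum-pres-∣ (λ i → weight (a (suc (toℕ i))) (b (suc (toℕ i))) (suc (toℕ i))) (step ∘ fromFin))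

lemma2p2-odd : (p n j : ℕ) → .{{_ : NonZero p}} → p ≡ suc (2 * n) → Prime p → 2 ≤ j → j ≤ p ∸ 1 →
               length (Lp p j) % 2 ≡ ((p * p ∸ 1) / 8) % 2
lemma2p2-odd .(suc (2 * n)) n (suc (suc k)) refl p-prime (s≤s (s≤s z≤n)) j≤2n = begin
  length (crossings ((2 * n) / 2) (suc k)) % 2  ≡⟨ cong (λ m → length (crossings m (suc k)) % 2) half-double ⟩
  length (crossings n (suc k)) % 2              ≡⟨ crossings-parity p-prime (∤-between (s≤s z≤n) k+1<p) (∤-between (s≤s z≤n) (s≤s j≤2n)) ⟩
  triangular n % 2                              ≡⟨ cong (_% 2) (odd-square n) ⟨
  ((p * p ∸ 1) / 8) % 2                         ∎
  where
  open OddModulus n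
  half-double : (2 * n) / 2 ≡ n
  half-double = trans (cong (_/ 2) (*-comm 2 n)) (m*n/n≡m n 2)
  k+1<p : suc k < p
  k+1<p = m≤n⇒m≤1+n j≤2n

lemma2p2 : (p j : ℕ) → .{{_ : NonZero p}} → Prime p → 3 < p → 2 ≤ j → j ≤ p ∸ 1 →
           length (Lp p j) % 2 ≡ ((p * p ∸ 1) / 8) % 2
lemma2p2 p j p-prime 3<p = lemma2p2-odd p (p / 2) j (prime-odd p-prime (<-trans (n<1+n 2) 3<p)) p-prime
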